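{- For every $n\ge1$, \[\#\widehat{P}_B(\emptyset,n)=\frac{3^n+1}{2}.\]
   Context: $B_n$ is the set of signed permutations $\pi=\pi_1\cdots\pi_n$: words with each $\pi_i\in\{ -n,\dots,-1,1,\dots,n\}$ and $\{|\pi_1|,\dots,|\pi_n|\}=\{1,\dots,n\}$. Set $\pi_0=0$. An index $i\in\{1,\dots,n-1\}$ is a peak of $\pi$ if $\pi_{i-1}<\pi_i>\pi_{i+1}$. $\widehat{P}_B(S,n)$ is the set of $\pi\in B_n$ whose peak set (in this sense) equals $S$; thus $\widehat{P}_B(\emptyset,n)$ is the set of signed permutations with no peaks when $\pi_0=0$ is prepended. -}

module Defs where

open import Data.Nat using (ℕ; zero; suc; _≤_)
open import Data.Integer using (ℤ; +_; ∣_∣; _<_)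
open import Data.List using (List; []; _∷_; map; length)
open import Data.List.Relation.Binary.Permutation.Propositional using (_↭_)
open import Data.List using (upTo)
open import Data.Product using (_×_)
open import Data.Sum using (_⊎_)
open import Data.Empty using (⊥)
open import Relation.Nullary using (¬_)
open import Relation.Binary.PropositionalEquality using (_≢_)

-- A signed permutation of [n] is a word π₁⋯πₙ of nonzero integers whose
-- absolute values are a permutation of 1,…,n.
-- (upTo n = 0 ∷ … ∷ n-1, so map suc (upTo n) = 1 ∷ … ∷ n.)
IsSignedPerm : ℕ → List ℤ → Set
IsSignedPerm n π = map ∣_∣ π ↭ map suc (upTo n)

-- Peak at position i of the word π₀ π₁ ⋯ πₙ with π₀ = 0:
-- π_{i-1} < π_i > π_{i+1}.  Peak positions i range over 1,…,n-1,
-- i.e. exactly over the interior positions of the word 0 ∷ π.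
HasPeak : List ℤ → Set
HasPeak [] = ⊥
HasPeak (a ∷ []) = ⊥
HasPeak (a ∷ b ∷ []) = ⊥
HasPeak (a ∷ b ∷ c ∷ w) = ((a < b) × (c < b)) ⊎ HasPeak (b ∷ c ∷ w)

NoPeaks : List ℤ → Set
NoPeaks π = ¬ HasPeak (+ 0 ∷ π)

-- A word 0 π₁ ⋯ πₙ with distinct neighbours is peakless iff it falls and then
-- rises: π = α ++ β with 0 > α₁ > α₂ > ⋯ and β increasing (a valley split of π).
-- In a peakless signed permutation of [n+1] the entry +(n+1) must come last and
-- -(n+1) must sit at the junction of a valley split of the rest.  So the peakless
-- signed permutations of [n+1] arise exactly once each from those σ of [n], as
-- σ ++ [n+1] and as α ++ -(n+1) ∷ β for each valley split (α , β) of σ.  Writing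
-- k(σ) for the number of valley splits, k(σ ++ [n+1]) = k(σ) and every
-- α ++ -(n+1) ∷ β has k = 2, so Σ k = 3ⁿ over the peakless σ of [n], and their
-- number a(n) satisfies a(n+1) = a(n) + 3ⁿ, whence 2 a(n) = 3ⁿ + 1.

module Submission where

open import Defs
open import Data.Nat using (ℕ; zero; suc; _+_; _*_; _^_; _≤_; z≤n; s≤s)
import Data.Nat.Properties as ℕ
open import Data.Nat.ListAction using (sum)
open import Data.Nat.ListAction.Properties using (sum-++)
open import Data.Nat.Tactic.RingSolver using (solve-∀)
open import Algebra.Properties.CommutativeSemigroup ℕ.+-commutativeSemigroup using (x∙yz≈y∙xz)
open import Data.Integer using (ℤ; +_; -[1+_]; ∣_∣; _<_; _>_; _<?_; -<-; -<+; +<+)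
import Data.Integer.Properties as ℤ
open import Data.List using (List; []; _∷_; _++_; _∷ʳ_; map; length; upTo; concatMap; filter)
open import Data.List.Properties
  using ( length-++; length-map; map-++; map-cong; map-cong-local; ++-identityʳ; upTo-∷ʳ
        ; filter-++; filter-all; filter-reject; ∷-injective)
open import Data.List.Membership.Propositional using (_∈_; find; lose)
open import Data.List.Membership.Propositional.Properties
  using (∈-map⁺; ∈-map⁻; ∈-++⁺ˡ; ∈-++⁺ʳ; ∈-++⁻; ∈-∃++; ∈-concatMap⁺; ∈-concatMap⁻; ∈-upTo⁺)
open import Data.List.Relation.Unary.Any using (here; there)
open import Data.List.Relation.Unary.All as All using (All; []; _∷_)
import Data.List.Relation.Unary.All.Properties as All
open import Data.List.Relation.Unary.AllPairs as AllPairs using ([]; _∷_)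
open import Data.List.Relation.Unary.Linked as Linked using (Linked; []; [-]; _∷_; linked?)
open import Data.List.Relation.Unary.Linked.Properties using (AllPairs⇒Linked; Linked⇒AllPairs)
open import Data.List.Relation.Unary.Unique.Propositional using (Unique)
import Data.List.Relation.Unary.Unique.Propositional.Properties as Unique
open import Data.List.Relation.Binary.Disjoint.Propositional using (Disjoint)
open import Data.List.Relation.Binary.Permutation.Propositional using (↭-refl; ↭-sym; ↭-trans; ↭-prep; ↭⇒↭ₛ)
import Data.List.Relation.Binary.Permutation.Propositional.Properties as ↭
open import Data.List.Relation.Binary.Permutation.Setoid.Properties using (Unique-resp-↭)
open import Data.Product using (_×_; _,_; proj₁; proj₂; ∃; ∃₂; Σ-syntax; map₁)
open import Data.Sum using (inj₁; inj₂)
open import Data.Empty using (⊥-elim)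
open import Function using (_∘_; _$_; _⇔_; mk⇔)
open import Relation.Nullary using (¬_; Dec; yes; no; ¬?)
open import Relation.Unary using (Decidable)
open import Relation.Binary using (tri<; tri≈; tri>)
open import Relation.Binary.PropositionalEquality
  using (_≡_; _≢_; refl; sym; trans; cong; cong₂; subst; setoid; module ≡-Reasoning)

module _ {A B : Set} where

  length-concatMap : ∀ (f : A → List B) xs → length (concatMap f xs) ≡ sum (map (length ∘ f) xs)
  length-concatMap f []       = refl
  length-concatMap f (x ∷ xs) = trans (length-++ (f x)) (cong (_+_ (length (f x))) (length-concatMap f xs))

  sum-map-concatMap : ∀ (g : B → ℕ) (f : A → List B) xs →
                      sum (map g (concatMap f xs)) ≡ sum (map (sum ∘ map g ∘ f) xs)
  sum-map-concatMap g f []       = refl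
  sum-map-concatMap g f (x ∷ xs) = begin
    sum (map g (f x ++ concatMap f xs))                ≡⟨ cong sum (map-++ g (f x) _) ⟩
    sum (map g (f x) ++ map g (concatMap f xs))        ≡⟨ sum-++ (map g (f x)) _ ⟩
    sum (map g (f x)) + sum (map g (concatMap f xs))   ≡⟨ cong (_+_ _) (sum-map-concatMap g f xs) ⟩
    sum (map g (f x)) + sum (map (sum ∘ map g ∘ f) xs) ∎
    where open ≡-Reasoning

  length-map-cong : ∀ (f : A → B) {xs ys} → length xs ≡ length ys → length (map f xs) ≡ length (map f ys)
  length-map-cong f {xs} {ys} eq = trans (length-map f xs) (trans eq (sym (length-map f ys)))

  map-unique-local : ∀ (f : A → B) {xs} → (∀ {x y} → x ∈ xs → y ∈ xs → f x ≡ f y → x ≡ y) →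
                     Unique xs → Unique (map f xs)
  map-unique-local f inj []           = []
  map-unique-local f inj (x∉xs ∷ !xs) =
    All.map⁺ (All.tabulate (λ y∈xs fx≡fy → All.lookup x∉xs y∈xs (inj (here refl) (there y∈xs) fx≡fy)))
    ∷ map-unique-local f (λ x∈ y∈ → inj (there x∈) (there y∈)) !xs

  concatMap-unique : ∀ (f : A → List B) (parent : B → A) {xs} → Unique xs →
                     (∀ {x} → x ∈ xs → Unique (f x)) →
                     (∀ {x y} → x ∈ xs → y ∈ f x → parent y ≡ x) →
                     Unique (concatMap f xs)
  concatMap-unique f parent {[]}     []            _  _   = []
  concatMap-unique f parent {x ∷ xs} (x∉xs ∷ !xs) !f par =
    Unique.++⁺ (!f (here refl)) (concatMap-unique f parent !xs (!f ∘ there) (par ∘ there)) disjoint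
    where
    disjoint : Disjoint (f x) (concatMap f xs)
    disjoint (y∈fx , y∈rest) with z , z∈xs , y∈fz ← find (∈-concatMap⁻ f y∈rest) =
      All.lookup x∉xs z∈xs (trans (sym (par (here refl) y∈fx)) (par (there z∈xs) y∈fz))

module _ {A : Set} where

  sum-map-* : ∀ k (f : A → ℕ) xs → sum (map (λ x → k * f x) xs) ≡ k * sum (map f xs)
  sum-map-* k f []       = sym (ℕ.*-zeroʳ k)
  sum-map-* k f (x ∷ xs) = trans (cong (_+_ (k * f x)) (sum-map-* k f xs)) (sym (ℕ.*-distribˡ-+ k (f x) _))

  sum-map-suc : ∀ (f : A → ℕ) xs → sum (map (suc ∘ f) xs) ≡ length xs + sum (map f xs)
  sum-map-suc f []       = refl
  sum-map-suc f (x ∷ xs) =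
    cong suc (trans (cong (_+_ (f x)) (sum-map-suc f xs)) (x∙yz≈y∙xz (f x) (length xs) _))

  sum-map-constant : ∀ {k} (f : A → ℕ) {xs} → All (λ x → f x ≡ k) xs → sum (map f xs) ≡ k * length xs
  sum-map-constant {k} f []           = sym (ℕ.*-zeroʳ k)
  sum-map-constant {k} f (refl ∷ fxs) = trans (cong (_+_ k) (sum-map-constant f fxs)) (sym (ℕ.*-suc k _))

keepIf : {P A : Set} → Dec P → List A → List A
keepIf (yes _) xs = xs
keepIf (no _)  _  = []

module _ {P A : Set} where

  ∈-keepIf⁺ : ∀ (d : Dec P) {xs : List A} {v} → P → v ∈ xs → v ∈ keepIf d xs
  ∈-keepIf⁺ (yes _) _ v∈ = v∈
  ∈-keepIf⁺ (no ¬p) p _  = ⊥-elim (¬p p)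

  ∈-keepIf⁻ : ∀ (d : Dec P) {xs : List A} {v} → v ∈ keepIf d xs → P × v ∈ xs
  ∈-keepIf⁻ (yes p) v∈ = p , v∈
  ∈-keepIf⁻ (no _)  ()

  keepIf-unique : ∀ (d : Dec P) {xs : List A} → Unique xs → Unique (keepIf d xs)
  keepIf-unique (yes _) !xs = !xs
  keepIf-unique (no _)  _   = []

-- Monotone words and peaks

Increasing : List ℤ → Set
Increasing = Linked _<_

Decreasing : List ℤ → Set
Decreasing = Linked _>_

increasing? : ∀ w → Dec (Increasing w)
increasing? = linked? _<?_

increasing-head< : ∀ {x xs} → Increasing (x ∷ xs) → All (x <_) xs
increasing-head< inc = AllPairs.head (Linked⇒AllPairs ℤ.<-trans inc)

increasing-∷ : ∀ {m β} → All (m <_) β → Increasing β → Increasing (m ∷ β)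
increasing-∷ []          []  = [-]
increasing-∷ (m<b ∷ _) inc = m<b ∷ inc

increasing-∷ʳ⁺ : ∀ {N} w → All (_< N) w → Increasing w → Increasing (w ∷ʳ N)
increasing-∷ʳ⁺ []          _              _           = [-]
increasing-∷ʳ⁺ (x ∷ [])    (x<N ∷ _)     _           = x<N ∷ [-]
increasing-∷ʳ⁺ (x ∷ y ∷ w) (_ ∷ y∷w<N) (x<y ∷ inc) = x<y ∷ increasing-∷ʳ⁺ (y ∷ w) y∷w<N inc

increasing-∷ʳ⁻ : ∀ {N} w → Increasing (w ∷ʳ N) → Increasing w
increasing-∷ʳ⁻ []          _           = []
increasing-∷ʳ⁻ (x ∷ [])    _           = [-]
increasing-∷ʳ⁻ (x ∷ y ∷ w) (x<y ∷ inc) = x<y ∷ increasing-∷ʳ⁻ (y ∷ w) inc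

linked-++⁻ʳ : ∀ {R : ℤ → ℤ → Set} u {w} → Linked R (u ++ w) → Linked R w
linked-++⁻ʳ []      lw = lw
linked-++⁻ʳ (_ ∷ u) lw = linked-++⁻ʳ u (Linked.tail lw)

hasPeak-∷ : ∀ {x} w → HasPeak w → HasPeak (x ∷ w)
hasPeak-∷ (a ∷ b ∷ c ∷ w) p = inj₂ p

hasPeak-++ˡ : ∀ u {w} → HasPeak w → HasPeak (u ++ w)
hasPeak-++ˡ []      p = p
hasPeak-++ˡ (x ∷ u) p = hasPeak-∷ (u ++ _) (hasPeak-++ˡ u p)

hasPeak-++ʳ : ∀ w {u} → HasPeak w → HasPeak (w ++ u)
hasPeak-++ʳ (a ∷ b ∷ c ∷ w) (inj₁ p) = inj₁ p
hasPeak-++ʳ (a ∷ b ∷ c ∷ w) (inj₂ p) = inj₂ (hasPeak-++ʳ (b ∷ c ∷ w) p)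

hasPeak-∷ʳ-max⁻ : ∀ {N} w → All (_< N) w → HasPeak (w ∷ʳ N) → HasPeak w
hasPeak-∷ʳ-max⁻ (a ∷ b ∷ [])    (_ ∷ b<N ∷ _) (inj₁ (_ , N<b)) = ⊥-elim (ℤ.<-asym b<N N<b)
hasPeak-∷ʳ-max⁻ (a ∷ b ∷ c ∷ w) _              (inj₁ p)         = inj₁ p
hasPeak-∷ʳ-max⁻ (a ∷ b ∷ c ∷ w) (_ ∷ b∷c∷w<N) (inj₂ p)         =
  inj₂ (hasPeak-∷ʳ-max⁻ (b ∷ c ∷ w) b∷c∷w<N p)

hasPeak-at-max : ∀ {M b} a α β → All (_< M) (a ∷ α) → b < M → HasPeak (a ∷ α ++ M ∷ b ∷ β)
hasPeak-at-max a []      β (a<M ∷ _)    b<M = inj₁ (a<M , b<M)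
hasPeak-at-max a (x ∷ α) β (_ ∷ x∷α<M) b<M = hasPeak-∷ (x ∷ α ++ _) (hasPeak-at-max x α β x∷α<M b<M)

hasPeak-fall : ∀ {a x} w → x < a → HasPeak (a ∷ x ∷ w) → HasPeak (x ∷ w)
hasPeak-fall (c ∷ w) x<a (inj₁ (a<x , _)) = ⊥-elim (ℤ.<-asym x<a a<x)
hasPeak-fall (c ∷ w) x<a (inj₂ p)         = p

increasing-noPeak : ∀ {a} β → Increasing β → ¬ HasPeak (a ∷ β)
increasing-noPeak (b ∷ c ∷ β) (b<c ∷ _)   (inj₁ (_ , c<b)) = ℤ.<-asym b<c c<b
increasing-noPeak (b ∷ c ∷ β) (_ ∷ inc) (inj₂ p)         = increasing-noPeak (c ∷ β) inc p

valley-noPeak : ∀ a α β → Decreasing (a ∷ α) → Increasing β → ¬ HasPeak (a ∷ α ++ β)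
valley-noPeak a []      β _           inc = increasing-noPeak β inc
valley-noPeak a (x ∷ α) β (x<a ∷ dec) inc = valley-noPeak x α β dec inc ∘ hasPeak-fall (α ++ β) x<a

ascent⇒increasing : ∀ {a b} γ → a < b → Linked _≢_ (b ∷ γ) → ¬ HasPeak (a ∷ b ∷ γ) →
                    Increasing (a ∷ b ∷ γ)
ascent⇒increasing []      a<b _            _  = a<b ∷ [-]
ascent⇒increasing {b = b} (c ∷ γ) a<b (b≢c ∷ ne) np with ℤ.<-cmp b c
... | tri< b<c _   _   = a<b ∷ ascent⇒increasing γ b<c ne (np ∘ inj₂)
... | tri≈ _   b≡c _   = ⊥-elim (b≢c b≡c)
... | tri> _   _   c<b = ⊥-elim (np (inj₁ (a<b , c<b)))

decreasing-before-min : ∀ {m} a α β → m < a → All (m <_) α → Linked _≢_ (a ∷ α ++ m ∷ β) →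
                        ¬ HasPeak (a ∷ α ++ m ∷ β) → Decreasing (a ∷ α)
decreasing-before-min a []      β _   _            _            _  = [-]
decreasing-before-min {m} a (x ∷ α) β m<a (m<x ∷ m<α) (a≢x ∷ ne) np with ℤ.<-cmp a x
... | tri< a<x _   _   = ⊥-elim (ℤ.<-asym m<x x<m)
  where
  x<m : x < m
  x<m = All.head (All.++⁻ʳ α (increasing-head< (Linked.tail (ascent⇒increasing (α ++ _) a<x ne np))))
... | tri≈ _   a≡x _   = ⊥-elim (a≢x a≡x)
... | tri> _   _   x<a = x<a ∷ decreasing-before-min x α β m<x m<α ne (np ∘ hasPeak-∷ (x ∷ α ++ _))

increasing-after-min : ∀ m β → All (m <_) β → Linked _≢_ (m ∷ β) → ¬ HasPeak (m ∷ β) → Increasing β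
increasing-after-min m []      _         _        _  = []
increasing-after-min m (b ∷ β) (m<b ∷ _) (_ ∷ ne) np = Linked.tail (ascent⇒increasing β m<b ne np)

-- Valley splits

Split : Set
Split = List ℤ × List ℤ

IsValleySplit : ℤ → Split → Set
IsValleySplit a (α , β) = Decreasing (a ∷ α) × Increasing β

valleySplits : ℤ → List ℤ → List Split
valleySplits a []       = ([] , []) ∷ []
valleySplits a (x ∷ xs) =
  keepIf (increasing? (x ∷ xs)) (([] , x ∷ xs) ∷ []) ++ keepIf (x <? a) (map (map₁ (x ∷_)) (valleySplits x xs))

valleyCount : ℤ → List ℤ → ℕ
valleyCount a π = length (valleySplits a π)

∈-valleySplits⁻ : ∀ a π {α β} → (α , β) ∈ valleySplits a π → α ++ β ≡ π × IsValleySplit a (α , β)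
∈-valleySplits⁻ a [] (here refl) = refl , [-] , []
∈-valleySplits⁻ a (x ∷ xs) s∈ with ∈-++⁻ (keepIf (increasing? (x ∷ xs)) _) s∈
... | inj₁ s∈₁ with ∈-keepIf⁻ (increasing? (x ∷ xs)) s∈₁
...   | inc , here refl = refl , [-] , inc
∈-valleySplits⁻ a (x ∷ xs) s∈ | inj₂ s∈₂ with ∈-keepIf⁻ (x <? a) s∈₂
...   | x<a , s∈′ with ∈-map⁻ (map₁ (x ∷_)) s∈′
...     | (α , β) , t∈ , refl with ∈-valleySplits⁻ x xs t∈
...       | refl , dec , inc = refl , x<a ∷ dec , inc

∈-valleySplits⁺ : ∀ a α β → IsValleySplit a (α , β) → (α , β) ∈ valleySplits a (α ++ β)
∈-valleySplits⁺ a []      []       _               = here refl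
∈-valleySplits⁺ a []      (x ∷ xs) (_ , inc)       = ∈-++⁺ˡ (∈-keepIf⁺ (increasing? (x ∷ xs)) inc (here refl))
∈-valleySplits⁺ a (x ∷ α) β        (x<a ∷ dec , inc) =
  ∈-++⁺ʳ _ (∈-keepIf⁺ (x <? a) x<a (∈-map⁺ (map₁ (x ∷_)) (∈-valleySplits⁺ x α β (dec , inc))))

valleySplits-unique : ∀ a π → Unique (valleySplits a π)
valleySplits-unique a []       = [] ∷ []
valleySplits-unique a (x ∷ xs) =
  Unique.++⁺ (keepIf-unique (increasing? (x ∷ xs)) ([] ∷ []))
             (keepIf-unique (x <? a) (Unique.map⁺ map₁-∷-injective (valleySplits-unique x xs)))
             disjoint
  where
  map₁-∷-injective : ∀ {s t : Split} → map₁ (x ∷_) s ≡ map₁ (x ∷_) t → s ≡ t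
  map₁-∷-injective {_ , _} {_ , _} refl = refl
  disjoint : Disjoint (keepIf (increasing? (x ∷ xs)) (([] , x ∷ xs) ∷ [])) _
  disjoint (s∈₁ , s∈₂)
    with ∈-keepIf⁻ (increasing? (x ∷ xs)) s∈₁ | ∈-map⁻ (map₁ (x ∷_)) (proj₂ (∈-keepIf⁻ (x <? a) s∈₂))
  ... | _ , here refl | _ , _ , ()

valleyCount-∷ʳ-max : ∀ {a N} π → a < N → All (_< N) π → valleyCount a (π ∷ʳ N) ≡ valleyCount a π
valleyCount-∷ʳ-max {a} {N} [] a<N _ with N <? a
... | yes N<a = ⊥-elim (ℤ.<-asym a<N N<a)
... | no _    = refl
valleyCount-∷ʳ-max {a} {N} (x ∷ xs) a<N (x<N ∷ xs<N)
  with tail-count ← length-map-cong (map₁ (x ∷_)) {valleySplits x (xs ∷ʳ N)} {valleySplits x xs}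
                                    (valleyCount-∷ʳ-max xs x<N xs<N)
  with increasing? (x ∷ xs ∷ʳ N) | increasing? (x ∷ xs) | x <? a
... | yes _   | yes _   | yes _ = cong suc tail-count
... | yes _   | yes _   | no _  = refl
... | no _    | no _    | yes _ = tail-count
... | no _    | no _    | no _  = refl
... | yes inc | no ¬inc | _     = ⊥-elim (¬inc (increasing-∷ʳ⁻ (x ∷ xs) inc))
... | no ¬inc | yes inc | _     = ⊥-elim (¬inc (increasing-∷ʳ⁺ (x ∷ xs) (x<N ∷ xs<N) inc))

valleyCount-increasing : ∀ {m} β → Increasing β → All (m <_) β → valleyCount m β ≡ 1
valleyCount-increasing []      _   _         = refl
valleyCount-increasing {m} (b ∷ β) inc (m<b ∷ _) with increasing? (b ∷ β) | b <? m
... | yes _   | no _    = refl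
... | no ¬inc | _       = ⊥-elim (¬inc inc)
... | yes _   | yes b<m = ⊥-elim (ℤ.<-asym m<b b<m)

-- The minimum m can end the falling part or start the rising part, and nowhere else.
valleyCount-min : ∀ {m} a α β → IsValleySplit a (α , β) → m < a → All (m <_) α → All (m <_) β →
                  valleyCount a (α ++ m ∷ β) ≡ 2
valleyCount-min {m} a [] β (_ , inc) m<a _ m<β with increasing? (m ∷ β) | m <? a
... | yes _    | yes _  = cong suc (trans (length-map _ (valleySplits m β)) (valleyCount-increasing β inc m<β))
... | no ¬inc  | _      = ⊥-elim (¬inc (increasing-∷ m<β inc))
... | yes _    | no m≮a = ⊥-elim (m≮a m<a)
valleyCount-min {m} a (x ∷ α) β (x<a ∷ dec , inc) m<a (m<x ∷ m<α) m<β
  with increasing? (x ∷ α ++ m ∷ β) | x <? a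
... | yes inc′ | _      = ⊥-elim (ℤ.<-asym m<x (All.head (All.++⁻ʳ α (increasing-head< inc′))))
... | no _     | no x≮a = ⊥-elim (x≮a x<a)
... | no _     | yes _  =
  trans (length-map _ (valleySplits x (α ++ m ∷ β))) (valleyCount-min x α β (dec , inc) m<x m<α m<β)

-- Signed permutations

map-suc-upTo-∷ʳ : ∀ n → map suc (upTo (suc n)) ≡ map suc (upTo n) ∷ʳ suc n
map-suc-upTo-∷ʳ n = trans (cong (map suc) (sym (upTo-∷ʳ n))) (map-++ suc (upTo n) (n ∷ []))

signedPerm-bounded : ∀ {n π} → IsSignedPerm n π → All (λ z → 1 ≤ ∣ z ∣ × ∣ z ∣ ≤ n) π
signedPerm-bounded {n} sp = All.map⁻ (↭.All-resp-↭ (↭-sym sp) bounded)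
  where
  bounded : All (λ k → 1 ≤ k × k ≤ n) (map suc (upTo n))
  bounded = All.map⁺ (All.map (λ k<n → s≤s z≤n , k<n) (All.all-upTo n))

signedPerm-<max : ∀ {n π} → IsSignedPerm n π → All (_< + suc n) π
signedPerm-<max = All.map below ∘ signedPerm-bounded
  where
  below : ∀ {n z} → 1 ≤ ∣ z ∣ × ∣ z ∣ ≤ n → z < + suc n
  below {z = + _}    (_ , k≤n) = +<+ (s≤s k≤n)
  below {z = -[1+ _ ]} _       = -<+

signedPerm->min : ∀ {n π} → IsSignedPerm n π → All (-[1+ n ] <_) π
signedPerm->min = All.map above ∘ signedPerm-bounded
  where
  above : ∀ {n z} → 1 ≤ ∣ z ∣ × ∣ z ∣ ≤ n → -[1+ n ] < z
  above {z = + _}      _         = -<+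
  above {z = -[1+ _ ]} (_ , k<n) = -<- k<n

signedPerm-abs≢suc : ∀ {n π} → IsSignedPerm n π → All (λ z → ∣ z ∣ ≢ suc n) π
signedPerm-abs≢suc = All.map (λ (_ , k≤n) eq → ℕ.<-irrefl eq (s≤s k≤n)) ∘ signedPerm-bounded

-- Neighbours in 0 ∷ π differ because 0, ∣π₁∣, …, ∣πₙ∣ are pairwise distinct.
signedPerm-neighbours≢ : ∀ {n π} → IsSignedPerm n π → Linked _≢_ (+ 0 ∷ π)
signedPerm-neighbours≢ {n} {π} sp = AllPairs⇒Linked (Unique.map⁻ (zero∉ ∷ abs-unique))
  where
  zero∉ : All (0 ≢_) (map ∣_∣ π)
  zero∉ = All.map⁺ (All.map (λ (1≤k , _) eq → ℕ.<-irrefl eq 1≤k) (signedPerm-bounded sp))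
  abs-unique : Unique (map ∣_∣ π)
  abs-unique = Unique-resp-↭ (setoid ℕ) (↭⇒↭ₛ (↭-sym sp)) (Unique.map⁺ ℕ.suc-injective (Unique.upTo⁺ n))

signedPerm-∷ʳ : ∀ {n π} → IsSignedPerm n π → IsSignedPerm (suc n) (π ∷ʳ + suc n)
signedPerm-∷ʳ {n} {π} sp rewrite map-++ ∣_∣ π (+ suc n ∷ []) | map-suc-upTo-∷ʳ n = ↭.++⁺ʳ (suc n ∷ []) sp

signedPerm-insert : ∀ {n} α β → IsSignedPerm n (α ++ β) → IsSignedPerm (suc n) (α ++ -[1+ n ] ∷ β)
signedPerm-insert {n} α β sp rewrite map-++ ∣_∣ α (-[1+ n ] ∷ β) | map-suc-upTo-∷ʳ n | map-++ ∣_∣ α β =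
  ↭-trans (↭.shift (suc n) (map ∣_∣ α) (map ∣_∣ β)) (↭-trans (↭-prep (suc n) sp) (↭.∷↭∷ʳ (suc n) _))

signedPerm-remove : ∀ {n x} α β → IsSignedPerm (suc n) (α ++ x ∷ β) → ∣ x ∣ ≡ suc n →
                    IsSignedPerm n (α ++ β)
signedPerm-remove {n} {x} α β sp eq rewrite map-++ ∣_∣ α (x ∷ β) | map-suc-upTo-∷ʳ n | eq | map-++ ∣_∣ α β =
  ↭.drop-∷ (↭-trans (↭-sym (↭.shift (suc n) (map ∣_∣ α) (map ∣_∣ β)))
                    (↭-trans sp (↭-sym (↭.∷↭∷ʳ (suc n) _))))

signedPerm-split-max : ∀ {n π} → IsSignedPerm (suc n) π →
                       ∃₂ λ α β → ∃ λ x → π ≡ α ++ x ∷ β × ∣ x ∣ ≡ suc n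
signedPerm-split-max {n} sp
  with x , x∈π , eq ← ∈-map⁻ ∣_∣ (↭.∈-resp-↭ (↭-sym sp) (∈-map⁺ suc (∈-upTo⁺ (ℕ.n<1+n n))))
  with α , β , refl ← ∈-∃++ x∈π = α , β , x , refl , sym eq

-- Enumerating peakless signed permutations

insertAt : ℤ → Split → List ℤ
insertAt m (α , β) = α ++ m ∷ β

children : ℕ → List ℤ → List (List ℤ)
children n π = (π ∷ʳ + suc n) ∷ map (insertAt -[1+ n ]) (valleySplits (+ 0) π)

enum : ℕ → List (List ℤ)
enum zero    = [] ∷ []
enum (suc n) = concatMap (children n) (enum n)

children-sound : ∀ {n σ π} → IsSignedPerm n σ × NoPeaks σ → π ∈ children n σ →
                 IsSignedPerm (suc n) π × NoPeaks π
children-sound {n} {σ} (sp , np) (here refl) =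
  signedPerm-∷ʳ sp , np ∘ hasPeak-∷ʳ-max⁻ (+ 0 ∷ σ) (+<+ (s≤s z≤n) ∷ signedPerm-<max sp)
children-sound {n} {σ} (sp , np) (there π∈)
  with (α , β) , s∈ , refl ← ∈-map⁻ (insertAt -[1+ n ]) π∈
  with refl , dec , inc ← ∈-valleySplits⁻ (+ 0) σ s∈ =
  signedPerm-insert α β sp ,
  valley-noPeak (+ 0) α (-[1+ n ] ∷ β) dec (increasing-∷ (All.++⁻ʳ α (signedPerm->min sp)) inc)

enum-sound : ∀ n {π} → π ∈ enum n → IsSignedPerm n π × NoPeaks π
enum-sound zero    (here refl) = ↭-refl , λ ()
enum-sound (suc n) π∈ with σ , σ∈ , π∈′ ← find (∈-concatMap⁻ (children n) π∈) =
  children-sound (enum-sound n σ∈) π∈′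

enum-complete-step : ∀ n → (∀ σ → IsSignedPerm n σ → NoPeaks σ → σ ∈ enum n) →
                     ∀ α x β → IsSignedPerm (suc n) (α ++ x ∷ β) → NoPeaks (α ++ x ∷ β) →
                     ∣ x ∣ ≡ suc n → α ++ x ∷ β ∈ enum (suc n)
enum-complete-step n complete α (+ _) [] sp np refl =
  ∈-concatMap⁺ (children n) (lose (complete α sp′ (np ∘ hasPeak-++ʳ (+ 0 ∷ α))) (here refl))
  where
  sp′ : IsSignedPerm n α
  sp′ = subst (IsSignedPerm n) (++-identityʳ α) (signedPerm-remove α [] sp refl)
enum-complete-step n complete α (+ _) (b ∷ β) sp np refl =
  ⊥-elim (np (hasPeak-at-max (+ 0) α β (+<+ (s≤s z≤n) ∷ All.++⁻ˡ α below) (All.head (All.++⁻ʳ α below))))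
  where
  below : All (_< + suc n) (α ++ b ∷ β)
  below = signedPerm-<max (signedPerm-remove α (b ∷ β) sp refl)
enum-complete-step n complete α -[1+ _ ] β sp np refl =
  ∈-concatMap⁺ (children n)
    (lose (complete (α ++ β) sp′ (valley-noPeak (+ 0) α β dec inc))
          (there (∈-map⁺ (insertAt -[1+ n ]) (∈-valleySplits⁺ (+ 0) α β (dec , inc)))))
  where
  sp′ : IsSignedPerm n (α ++ β)
  sp′ = signedPerm-remove α β sp refl
  above : All (-[1+ n ] <_) (α ++ β)
  above = signedPerm->min sp′
  ne : Linked _≢_ (+ 0 ∷ α ++ -[1+ n ] ∷ β)
  ne = signedPerm-neighbours≢ sp
  dec : Decreasing (+ 0 ∷ α)
  dec = decreasing-before-min (+ 0) α β -<+ (All.++⁻ˡ α above) ne np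
  inc : Increasing β
  inc = increasing-after-min -[1+ n ] β (All.++⁻ʳ α above)
          (linked-++⁻ʳ (+ 0 ∷ α) ne) (np ∘ hasPeak-++ˡ (+ 0 ∷ α))

enum-complete : ∀ n π → IsSignedPerm n π → NoPeaks π → π ∈ enum n
enum-complete zero    []      _  _ = here refl
enum-complete zero    (_ ∷ _) sp _ with () ← ↭.↭-length sp
enum-complete (suc n) π       sp np with α , β , x , refl , eq ← signedPerm-split-max sp =
  enum-complete-step n (enum-complete n) α x β sp np eq

abs≢? : ∀ k → Decidable (λ z → ∣ z ∣ ≢ k)
abs≢? k z = ¬? (∣ z ∣ ℕ.≟ k)

dropAbs : ℕ → List ℤ → List ℤ
dropAbs k = filter (abs≢? k)

dropAbs-insert : ∀ {k x} α β → All (λ z → ∣ z ∣ ≢ k) (α ++ β) → ∣ x ∣ ≡ k →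
                 dropAbs k (α ++ x ∷ β) ≡ α ++ β
dropAbs-insert {k} {x} α β α++β≢k x≡k = begin
  dropAbs k (α ++ x ∷ β)           ≡⟨ filter-++ (abs≢? k) α (x ∷ β) ⟩
  dropAbs k α ++ dropAbs k (x ∷ β) ≡⟨ cong (dropAbs k α ++_) (filter-reject (abs≢? k) {x} {β} (_$ x≡k)) ⟩
  dropAbs k α ++ dropAbs k β       ≡⟨ filter-++ (abs≢? k) α β ⟨
  dropAbs k (α ++ β)               ≡⟨ filter-all (abs≢? k) α++β≢k ⟩
  α ++ β                           ∎
  where open ≡-Reasoning

children-parent : ∀ {n σ π} → IsSignedPerm n σ → π ∈ children n σ → dropAbs (suc n) π ≡ σ
children-parent {σ = σ} sp (here refl) =
  trans (dropAbs-insert σ [] (subst (All _) (sym (++-identityʳ σ)) (signedPerm-abs≢suc sp)) refl)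
        (++-identityʳ σ)
children-parent {n} {σ} sp (there π∈)
  with (α , β) , s∈ , refl ← ∈-map⁻ (insertAt -[1+ n ]) π∈
  with refl , _ ← ∈-valleySplits⁻ (+ 0) σ s∈ = dropAbs-insert α β (signedPerm-abs≢suc sp) refl

insertAt-injective : ∀ {m} α α' {β β'} → All (_≢ m) α → All (_≢ m) α' →
                     insertAt m (α , β) ≡ insertAt m (α' , β') → (α , β) ≡ (α' , β')
insertAt-injective []      []       _           _             refl = refl
insertAt-injective []      (_ ∷ _)  _           (y≢m ∷ _)    refl = ⊥-elim (y≢m refl)
insertAt-injective (_ ∷ _) []       (x≢m ∷ _)  _             refl = ⊥-elim (x≢m refl)
insertAt-injective (x ∷ α) (y ∷ α') (_ ∷ α≢m) (_ ∷ α'≢m) eq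
  with refl , eq′ ← ∷-injective eq
  with refl ← insertAt-injective α α' α≢m α'≢m eq′ = refl

children-unique : ∀ {n σ} → IsSignedPerm n σ → Unique (children n σ)
children-unique {n} {σ} sp =
  All.tabulate appended≢inserted
  ∷ map-unique-local (insertAt -[1+ n ]) inserted-injective (valleySplits-unique (+ 0) σ)
  where
  σ≢min : All (_≢ -[1+ n ]) σ
  σ≢min = All.map (λ min<z z≡min → ℤ.<-irrefl (sym z≡min) min<z) (signedPerm->min sp)
  appended≢inserted : ∀ {π} → π ∈ map (insertAt -[1+ n ]) (valleySplits (+ 0) σ) → σ ∷ʳ + suc n ≢ π
  appended≢inserted π∈ eq with (α , β) , _ , refl ← ∈-map⁻ (insertAt -[1+ n ]) π∈ =
    All.lookup (All.++⁺ σ≢min ((λ ()) ∷ [])) (subst (-[1+ n ] ∈_) (sym eq) (∈-++⁺ʳ α (here refl))) refl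
  inserted-injective : ∀ {s t} → s ∈ valleySplits (+ 0) σ → t ∈ valleySplits (+ 0) σ →
                       insertAt -[1+ n ] s ≡ insertAt -[1+ n ] t → s ≡ t
  inserted-injective {α , _} {α' , _} s∈ t∈
    with eq₁ , _ ← ∈-valleySplits⁻ (+ 0) σ s∈ | eq₂ , _ ← ∈-valleySplits⁻ (+ 0) σ t∈ =
    insertAt-injective α α' (All.++⁻ˡ α (subst (All _) (sym eq₁) σ≢min))
                            (All.++⁻ˡ α' (subst (All _) (sym eq₂) σ≢min))

enum-unique : ∀ n → Unique (enum n)
enum-unique zero    = [] ∷ []
enum-unique (suc n) =
  concatMap-unique (children n) (dropAbs (suc n)) (enum-unique n)
    (children-unique ∘ proj₁ ∘ enum-sound n) (children-parent ∘ proj₁ ∘ enum-sound n)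

-- Counting

children-valleyCount : ∀ {n σ} → IsSignedPerm n σ →
                       sum (map (valleyCount (+ 0)) (children n σ)) ≡ 3 * valleyCount (+ 0) σ
children-valleyCount {n} {σ} sp = begin
  valleyCount (+ 0) (σ ∷ʳ + suc n) + sum (map (valleyCount (+ 0)) inserted)
    ≡⟨ cong₂ _+_ (valleyCount-∷ʳ-max σ (+<+ (s≤s z≤n)) (signedPerm-<max sp))
                 (sum-map-constant (valleyCount (+ 0)) (All.map⁺ (All.tabulate inserted-count))) ⟩
  valleyCount (+ 0) σ + 2 * length inserted
    ≡⟨ cong (λ k → valleyCount (+ 0) σ + 2 * k) (length-map (insertAt -[1+ n ]) (valleySplits (+ 0) σ)) ⟩
  3 * valleyCount (+ 0) σ ∎
  where
  open ≡-Reasoning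
  inserted : List (List ℤ)
  inserted = map (insertAt -[1+ n ]) (valleySplits (+ 0) σ)
  inserted-count : ∀ {s} → s ∈ valleySplits (+ 0) σ → valleyCount (+ 0) (insertAt -[1+ n ] s) ≡ 2
  inserted-count {α , β} s∈ with refl , valley ← ∈-valleySplits⁻ (+ 0) σ s∈ =
    valleyCount-min (+ 0) α β valley -<+ (All.++⁻ˡ α (signedPerm->min sp)) (All.++⁻ʳ α (signedPerm->min sp))

enum-valleyCount : ∀ n → sum (map (valleyCount (+ 0)) (enum n)) ≡ 3 ^ n
enum-valleyCount zero    = refl
enum-valleyCount (suc n) = begin
  sum (map (valleyCount (+ 0)) (concatMap (children n) (enum n)))
    ≡⟨ sum-map-concatMap (valleyCount (+ 0)) (children n) (enum n) ⟩
  sum (map (sum ∘ map (valleyCount (+ 0)) ∘ children n) (enum n))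
    ≡⟨ cong sum (map-cong-local (All.tabulate (children-valleyCount ∘ proj₁ ∘ enum-sound n))) ⟩
  sum (map (λ σ → 3 * valleyCount (+ 0) σ) (enum n))
    ≡⟨ sum-map-* 3 (valleyCount (+ 0)) (enum n) ⟩
  3 * sum (map (valleyCount (+ 0)) (enum n))
    ≡⟨ cong (3 *_) (enum-valleyCount n) ⟩
  3 ^ suc n ∎
  where open ≡-Reasoning

enum-length-suc : ∀ n → length (enum (suc n)) ≡ length (enum n) + 3 ^ n
enum-length-suc n = begin
  length (concatMap (children n) (enum n))
    ≡⟨ length-concatMap (children n) (enum n) ⟩
  sum (map (length ∘ children n) (enum n))
    ≡⟨ cong sum (map-cong (λ σ → cong suc (length-map _ (valleySplits (+ 0) σ))) (enum n)) ⟩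
  sum (map (suc ∘ valleyCount (+ 0)) (enum n))
    ≡⟨ sum-map-suc (valleyCount (+ 0)) (enum n) ⟩
  length (enum n) + sum (map (valleyCount (+ 0)) (enum n))
    ≡⟨ cong (_+_ (length (enum n))) (enum-valleyCount n) ⟩
  length (enum n) + 3 ^ n ∎
  where open ≡-Reasoning

enum-count : ∀ n → 2 * length (enum n) ≡ 3 ^ n + 1
enum-count zero    = refl
enum-count (suc n) = begin
  2 * length (enum (suc n))        ≡⟨ cong (2 *_) (enum-length-suc n) ⟩
  2 * (length (enum n) + 3 ^ n)    ≡⟨ ℕ.*-distribˡ-+ 2 (length (enum n)) (3 ^ n) ⟩
  2 * length (enum n) + 2 * 3 ^ n  ≡⟨ cong (_+ 2 * 3 ^ n) (enum-count n) ⟩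
  3 ^ n + 1 + 2 * 3 ^ n            ≡⟨ rearrange (3 ^ n) ⟩
  3 * 3 ^ n + 1                    ∎
  where
  open ≡-Reasoning
  rearrange : ∀ t → t + 1 + 2 * t ≡ 3 * t + 1
  rearrange = solve-∀

theorem3p3 : (n : ℕ) → 1 ≤ n →
    Σ[ L ∈ List (List ℤ) ]
      (Unique L
      × ((π : List ℤ) → (π ∈ L) ⇔ (IsSignedPerm n π × NoPeaks π))
      × 2 * length L ≡ 3 ^ n + 1)
theorem3p3 n _ =
  enum n , enum-unique n , (λ π → mk⇔ (enum-sound n) (λ (sp , np) → enum-complete n π sp np)) , enum-count n
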